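{- Let $\Delta$ be a positive integer and $h\ge0$ an integer with $h\le g(\Delta)$. Then the persistent pebbling price of the complete binary tree of height $h$ is at most $h+\Delta$.
   Context: $g$ is defined on positive integers by $g(1)=0$ and $g(\Delta)=2^{g(\Delta-1)+\Delta-2}+g(\Delta-1)$ for $\Delta\ge2$. The complete binary tree of height $h$ has edges directed from children to parents (leaves are sources, the root is the unique sink). A reversible pebbling is a sequence of vertex sets $P_0,\dots,P_\tau$, each obtained from the previous by placing a pebble on $v\notin P$ with all predecessors of $v$ in $P$, or removing a pebble from $v\in P$ with all predecessors of $v$ in $P$; its space is $\max_t|P_t|$. The persistent pebbling price of a single-sink DAG is the minimum space of a reversible pebbling from $\emptyset$ to the configuration consisting of the sink only. -}

module Defs where

open import Data.Nat using (ℕ; zero; suc; _+_; _*_; _^_; _≤_)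
open import Data.Bool using (not)
open import Data.Fin using (Fin; toℕ)
open import Data.Fin.Subset using (Subset; _∈_; ∣_∣; ⊥; ⁅_⁆)
open import Data.Vec using (_[_]%=_)
open import Data.Product using (Σ; _×_)
open import Data.Sum using (_⊎_)
open import Relation.Binary.PropositionalEquality using (_≡_)

-- g(1) = 0, g(Δ) = 2^(g(Δ-1)+Δ-2) + g(Δ-1) for Δ ≥ 2  (g 0 is an unused junk value)
g : ℕ → ℕ
g zero = zero
g (suc zero) = zero
g (suc (suc d)) = 2 ^ (g (suc d) + d) + g (suc d)

-- Complete binary tree of height h, heap-indexed: vertices are Fin (treeSize h),
-- treeSize h = 2^(h+1) - 1; vertex index k has children 2k+1 and 2k+2
-- (when these are < treeSize h); the root is index 0.
-- Edges go from children to parents, so the predecessors of v are its children.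
inner : ℕ → ℕ
inner zero = zero
inner (suc h) = suc (suc (inner h + inner h))

treeSize : ℕ → ℕ
treeSize h = suc (inner h)

root : (h : ℕ) → Fin (treeSize h)
root h = Fin.zero

IsPred : {n : ℕ} → Fin n → Fin n → Set
IsPred u v = (toℕ u ≡ suc (2 * toℕ v)) ⊎ (toℕ u ≡ suc (suc (2 * toℕ v)))

PredsIn : (h : ℕ) → Subset (treeSize h) → Fin (treeSize h) → Set
PredsIn h P v = (u : Fin (treeSize h)) → IsPred u v → u ∈ P

Step : (h : ℕ) → Subset (treeSize h) → Subset (treeSize h) → Set
Step h P Q = Σ (Fin (treeSize h)) (λ v → PredsIn h P v × (Q ≡ P [ v ]%= not))

data Pebbling (h s : ℕ) : Subset (treeSize h) → Subset (treeSize h) → Set where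
  done : ∀ {P} → ∣ P ∣ ≤ s → Pebbling h s P P
  step : ∀ {P Q R} → ∣ P ∣ ≤ s → Step h P Q → Pebbling h s Q R → Pebbling h s P R

PersistentPriceAtMost : ℕ → ℕ → Set
PersistentPriceAtMost h s = Pebbling h s ⊥ ⁅ root h ⁆

{-# OPTIONS --safe #-}
-- If h ≤ g(Δ−1), Δ−1 spare pebbles suffice already. Otherwise
-- h = a + b with a = g(Δ−1) and 1 ≤ b ≤ 2^(a+Δ−2). Along the leftmost path of length b from the root, the b
-- subtrees hanging off it are lower than h and are pebbled one after another with Δ spare pebbles each (the
-- roots already pebbled add up to h + Δ − 1); the subtree of height a at the bottom of the path is then pebbled
-- with Δ−1 spare pebbles besides the b held ones. With all side inputs of the path pebbled, Bennett's reversible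
-- pebbling of a path of length b ≤ 2^c with c + 1 pebbles (c = a + Δ − 2) puts a pebble on the root within
-- h + Δ pebbles, and running the earlier stages backwards removes everything else.
module Submission where

open import Defs
open import Data.Nat using (ℕ; zero; suc; _+_; _*_; _∸_; _^_; _≤_; _<_; z≤n; s≤s; _≤?_; _<?_; >-nonZero)
open import Data.Nat.Properties
open import Data.Nat.Induction using (<-rec)
open import Data.Nat.Tactic.RingSolver using (solve-∀)
open import Data.Bool using (true; false; not; _∨_)
open import Data.Bool.Properties using (not-involutive)
open import Data.Fin as Fin using (Fin; toℕ; fromℕ<)
open import Data.Fin.Properties using (toℕ-injective; toℕ-fromℕ<; toℕ<n)
open import Data.Fin.Subset using (Subset; _∈_; _∉_; ∣_∣; ⊥; ⁅_⁆; _∪_)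
open import Data.Fin.Subset.Properties
  using (p⊆p∪q; x∈p∪q⁺; x∈p∪q⁻; x∈⁅x⁆; x∈⁅y⁆⇒x≡y; ∣⁅x⁆∣≡1; ∣⊥∣≡0; ∉⊥; ∪-comm; ∪-assoc; ∪-identityˡ)
open import Data.Vec using ([]; _∷_; _[_]%=_; here; there)
open import Data.Vec.Properties using (updateAt-updateAt; updateAt-cong; updateAt-id; updateAt-minimal)
open import Data.Product using (∃-syntax; _×_; _,_)
open import Data.Sum using (_⊎_; inj₁; inj₂; [_,_]; map₂)
open import Data.Empty using (⊥-elim)
open import Function using (_∘_)
open import Relation.Nullary using (¬_; yes; no)
open import Relation.Binary.PropositionalEquality using (_≡_; _≢_; refl; sym; trans; cong; subst; ≢-sym; module ≡-Reasoning)

1≤2^ : ∀ k → 1 ≤ 2 ^ k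
1≤2^ = m^n>0 2

2≤2^ : ∀ {k} → 1 ≤ k → 2 ≤ 2 ^ k
2≤2^ = ^-monoʳ-≤ 2

2≤*2^ : ∀ {m i} → 1 ≤ m → 1 ≤ i → 2 ≤ m * 2 ^ i
2≤*2^ 1≤m 1≤i = *-mono-≤ 1≤m (2≤2^ 1≤i)

*2^-+ : ∀ x t j → x * 2 ^ t * 2 ^ j ≡ x * 2 ^ (j + t)
*2^-+ x t j = begin
  x * 2 ^ t * 2 ^ j   ≡⟨ *-assoc x (2 ^ t) (2 ^ j) ⟩
  x * (2 ^ t * 2 ^ j) ≡⟨ cong (x *_) (*-comm (2 ^ t) (2 ^ j)) ⟩
  x * (2 ^ j * 2 ^ t) ≡⟨ cong (x *_) (^-distribˡ-+-* 2 j t) ⟨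
  x * 2 ^ (j + t)     ∎
  where open ≡-Reasoning

*2^-suc : ∀ m i → m * 2 ^ suc i ≡ 2 * (m * 2 ^ i)
*2^-suc m i = trans (sym (*2^-+ m i 1)) (*-comm (m * 2 ^ i) 2)

*2^-monoʳ-≤ : ∀ m {i j} → i ≤ j → m * 2 ^ i ≤ m * 2 ^ j
*2^-monoʳ-≤ m i≤j = *-monoʳ-≤ m (^-monoʳ-≤ 2 i≤j)

*2^-monoʳ-< : ∀ {m i j} → 1 ≤ m → i < j → m * 2 ^ i < m * 2 ^ j
*2^-monoʳ-< {m} 1≤m i<j = *-monoʳ-< m {{>-nonZero 1≤m}} (^-monoʳ-< 2 (s≤s (s≤s z≤n)) i<j)

*2^-cancelʳ-< : ∀ m {i j} → m * 2 ^ i < m * 2 ^ j → i < j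
*2^-cancelʳ-< m lt = ≰⇒> (λ j≤i → <⇒≱ lt (*2^-monoʳ-≤ m j≤i))

*2^-injective : ∀ {m i j} → 1 ≤ m → m * 2 ^ i ≡ m * 2 ^ j → i ≡ j
*2^-injective 1≤m eq = ≤-antisym
  (≮⇒≥ λ j<i → <-irrefl (sym eq) (*2^-monoʳ-< 1≤m j<i))
  (≮⇒≥ λ i<j → <-irrefl eq (*2^-monoʳ-< 1≤m i<j))

2*-*2^-≤ : ∀ m {i j} → i < j → 2 * (m * 2 ^ i) ≤ m * 2 ^ j
2*-*2^-≤ m {i} {j} i<j = subst (_≤ m * 2 ^ j) (*2^-suc m i) (*2^-monoʳ-≤ m i<j)

*2^<suc*2^ : ∀ x e → x * 2 ^ e < suc x * 2 ^ e
*2^<suc*2^ x e = m<n+m (x * 2 ^ e) (1≤2^ e)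

[2+x]*y≤2*[x*y] : ∀ {x} y → 2 ≤ x → (2 + x) * y ≤ 2 * (x * y)
[2+x]*y≤2*[x*y] {x} y 2≤x = begin
  (2 + x) * y       ≡⟨ *-distribʳ-+ y 2 x ⟩
  2 * y + x * y     ≤⟨ +-monoˡ-≤ (x * y) (*-monoˡ-≤ y 2≤x) ⟩
  x * y + x * y     ≡⟨ cong (x * y +_) (+-identityʳ (x * y)) ⟨
  2 * (x * y)       ∎
  where open ≤-Reasoning

-- Heap nodes are numbered from 1 (vertex k of the tree is node k + 1), so that the children of n are 2n and 2n + 1
-- and the descendants of A at depth e are exactly the nodes in [A·2^e, (A+1)·2^e).
infix 4 _≼[_]_ _≼_

record _≼[_]_ (A e y : ℕ) : Set where
  constructor within
  field
    lower : A * 2 ^ e ≤ y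
    upper : y < suc A * 2 ^ e

_≼_ : ℕ → ℕ → Set
A ≼ y = ∃[ e ] A ≼[ e ] y

≼-refl : ∀ A → A ≼ A
≼-refl A = 0 , within (≤-reflexive (*-identityʳ A)) (≤-reflexive (sym (*-identityʳ (suc A))))

≼-trans : ∀ {A B C} → A ≼ B → B ≼ C → A ≼ C
≼-trans {A} {B} {C} (e , within A≤B B<) (f , within B≤C C<) = f + e , within
  (subst (_≤ C) (*2^-+ A e f) (≤-trans (*-monoˡ-≤ (2 ^ f) A≤B) B≤C))
  (<-≤-trans C< (subst (suc B * 2 ^ f ≤_) (*2^-+ (suc A) e f) (*-monoˡ-≤ (2 ^ f) B<)))

≼⇒≤ : ∀ {A y} → A ≼ y → A ≤ y
≼⇒≤ {A} (e , within lo _) = ≤-trans (m≤m*n A (2 ^ e) {{m^n≢0 2 e}}) lo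

≼[]-spine : ∀ m t → m ≼[ t ] m * 2 ^ t
≼[]-spine m t = within ≤-refl (*2^<suc*2^ m t)

≼[]-sibling : ∀ m {t} → 1 ≤ t → m ≼[ t ] suc (m * 2 ^ t)
≼[]-sibling m {t} 1≤t = within (n≤1+n _) (+-monoˡ-≤ (m * 2 ^ t) (2≤2^ 1≤t))

-- With X = m·2^i and i ≥ 1, a spine node m·2^j beyond X·2^e is at least 2·X·2^e ≥ (X+2)·2^e.
spine-gap : ∀ {m i} j e → 1 ≤ m → 1 ≤ i → m * 2 ^ i * 2 ^ e < m * 2 ^ j → ¬ m * 2 ^ j < (2 + m * 2 ^ i) * 2 ^ e
spine-gap {m} {i} j e 1≤m 1≤i below above = <-irrefl refl (begin-strict
  m * 2 ^ j                  <⟨ above ⟩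
  (2 + m * 2 ^ i) * 2 ^ e    ≤⟨ [2+x]*y≤2*[x*y] (2 ^ e) (2≤*2^ 1≤m 1≤i) ⟩
  2 * (m * 2 ^ i * 2 ^ e)    ≡⟨ cong (2 *_) (*2^-+ m i e) ⟩
  2 * (m * 2 ^ (e + i))      ≤⟨ 2*-*2^-≤ m (*2^-cancelʳ-< m {e + i} {j} (subst (_< m * 2 ^ j) (*2^-+ m i e) below)) ⟩
  m * 2 ^ j                  ∎)
  where open ≤-Reasoning

sibling-⋠-spine : ∀ {m i} j → 1 ≤ m → 1 ≤ i → ¬ suc (m * 2 ^ i) ≼ m * 2 ^ j
sibling-⋠-spine {m} {i} j 1≤m 1≤i (e , within lo hi) =
  spine-gap j e 1≤m 1≤i (<-≤-trans (*2^<suc*2^ (m * 2 ^ i) e) lo) hi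

sibling-⋠-sibling : ∀ {m i j} → 1 ≤ m → 1 ≤ i → i ≢ j → ¬ suc (m * 2 ^ i) ≼ suc (m * 2 ^ j)
sibling-⋠-sibling {m} {i} {j} 1≤m 1≤i i≢j (zero , within lo hi) = i≢j (*2^-injective {i = i} {j} 1≤m (≤-antisym X≤Y Y≤X))
  where
  X≤Y : m * 2 ^ i ≤ m * 2 ^ j
  X≤Y = ≤-pred (subst (_≤ suc (m * 2 ^ j)) (*-identityʳ _) lo)
  Y≤X : m * 2 ^ j ≤ m * 2 ^ i
  Y≤X = ≤-pred (≤-pred (subst (suc (suc (m * 2 ^ j)) ≤_) (*-identityʳ _) hi))
sibling-⋠-sibling {m} {i} {j} 1≤m 1≤i _ (suc e , within lo hi) =
  spine-gap j (suc e) 1≤m 1≤i below (<-trans (n<1+n _) hi)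
  where
  below : m * 2 ^ i * 2 ^ suc e < m * 2 ^ j
  below = ≤-pred (≤-trans (+-monoˡ-≤ (m * 2 ^ i * 2 ^ suc e) (2≤2^ {suc e} (s≤s z≤n))) lo)

spine-⋠-sibling : ∀ {m i b} → 1 ≤ m → 1 ≤ i → i ≤ b → ¬ m * 2 ^ b ≼ suc (m * 2 ^ i)
spine-⋠-sibling {m} {i} {b} 1≤m 1≤i i≤b (e , within lo hi) = <-irrefl refl (begin-strict
  suc (m * 2 ^ i)        <⟨ +-monoˡ-≤ X (2≤*2^ 1≤m 1≤i) ⟩
  X + X                  ≡⟨ cong (X +_) (+-identityʳ X) ⟨
  2 * X                  ≤⟨ 2*-*2^-≤ m (i<e+b e hi) ⟩
  m * 2 ^ (e + b)        ≡⟨ *2^-+ m b e ⟨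
  m * 2 ^ b * 2 ^ e      ≤⟨ lo ⟩
  suc (m * 2 ^ i)        ∎)
  where
  open ≤-Reasoning
  X = m * 2 ^ i
  i<e+b : ∀ e → suc X < suc (m * 2 ^ b) * 2 ^ e → i < e + b
  i<e+b zero    hi′ = *2^-cancelʳ-< m {i} {b} (≤-pred (subst (suc (suc X) ≤_) (*-identityʳ _) hi′))
  i<e+b (suc _) _   = s≤s (≤-trans i≤b (m≤n+m b _))

-- In the tree of height H, node m has height k: its descendants at depth k are leaves of the tree.
record AtHeight (H k m : ℕ) : Set where
  constructor at-height
  field
    reaches-bottom : 2 ^ H ≤ m * 2 ^ k
    inside-tree    : suc m * 2 ^ k ≤ 2 ^ suc H

AtHeight-≼ : ∀ {H j t m y} → AtHeight H (j + t) m → m ≼[ t ] y → AtHeight H j y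
AtHeight-≼ {H} {j} {t} {m} {y} (at-height top bottom) (within lo hi) = at-height
  (≤-trans top (subst (_≤ y * 2 ^ j) (*2^-+ m t j) (*-monoˡ-≤ (2 ^ j) lo)))
  (≤-trans (subst (suc y * 2 ^ j ≤_) (*2^-+ (suc m) t j) (*-monoˡ-≤ (2 ^ j) hi)) bottom)

AtHeight-root : ∀ H → AtHeight H H 1
AtHeight-root H = at-height (≤-reflexive (sym (*-identityˡ (2 ^ H)))) ≤-refl

AtHeight⇒1≤ : ∀ {H k m} → AtHeight H k m → 1 ≤ m
AtHeight⇒1≤ {H} {k} {zero} (at-height top _) = ⊥-elim (<-irrefl refl (≤-trans (1≤2^ H) top))
AtHeight⇒1≤ {m = suc _} _ = s≤s z≤n

AtHeight⇒< : ∀ {H k m} → AtHeight H k m → m < 2 ^ suc H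
AtHeight⇒< {H} {k} {m} (at-height _ bottom) = ≤-trans (m≤m*n (suc m) (2 ^ k) {{m^n≢0 2 k}}) bottom

AtHeight-0 : ∀ {H m} → AtHeight H 0 m → 2 ^ suc H ≤ 2 * m
AtHeight-0 {H} {m} (at-height top _) = *-monoʳ-≤ 2 (subst (2 ^ H ≤_) (*-identityʳ m) top)

AtHeight-spine : ∀ {H k m t} → t ≤ k → AtHeight H k m → AtHeight H (k ∸ t) (m * 2 ^ t)
AtHeight-spine {H} {k} {m} {t} t≤k hm =
  AtHeight-≼ {j = k ∸ t} (subst (λ z → AtHeight H z m) (sym (m∸n+n≡m t≤k)) hm) (≼[]-spine m t)

AtHeight-sibling : ∀ {H k m t} → 1 ≤ t → t ≤ k → AtHeight H k m → AtHeight H (k ∸ t) (suc (m * 2 ^ t))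
AtHeight-sibling {H} {k} {m} {t} 1≤t t≤k hm =
  AtHeight-≼ {j = k ∸ t} (subst (λ z → AtHeight H z m) (sym (m∸n+n≡m t≤k)) hm) (≼[]-sibling m 1≤t)

∣p∪q∣≤∣p∣+∣q∣ : ∀ {n} (p q : Subset n) → ∣ p ∪ q ∣ ≤ ∣ p ∣ + ∣ q ∣
∣p∪q∣≤∣p∣+∣q∣ [] [] = z≤n
∣p∪q∣≤∣p∣+∣q∣ (true ∷ p) (true ∷ q) = s≤s (≤-trans (∣p∪q∣≤∣p∣+∣q∣ p q) (+-monoʳ-≤ ∣ p ∣ (n≤1+n _)))
∣p∪q∣≤∣p∣+∣q∣ (true ∷ p) (false ∷ q) = s≤s (∣p∪q∣≤∣p∣+∣q∣ p q)
∣p∪q∣≤∣p∣+∣q∣ (false ∷ p) (true ∷ q) = subst (∣ (false ∷ p) ∪ (true ∷ q) ∣ ≤_) (sym (+-suc ∣ p ∣ ∣ q ∣)) (s≤s (∣p∪q∣≤∣p∣+∣q∣ p q))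
∣p∪q∣≤∣p∣+∣q∣ (false ∷ p) (false ∷ q) = ∣p∪q∣≤∣p∣+∣q∣ p q

∣⁅x⁆∪p∣≤1+∣p∣ : ∀ {n} (x : Fin n) (p : Subset n) → ∣ ⁅ x ⁆ ∪ p ∣ ≤ suc ∣ p ∣
∣⁅x⁆∪p∣≤1+∣p∣ x p = ≤-trans (∣p∪q∣≤∣p∣+∣q∣ ⁅ x ⁆ p) (≤-reflexive (cong (_+ ∣ p ∣) (∣⁅x⁆∣≡1 x)))

∈⁅x⁆∪p⁻ : ∀ {n} {y} (x : Fin n) (p : Subset n) → y ∈ ⁅ x ⁆ ∪ p → y ≡ x ⊎ y ∈ p
∈⁅x⁆∪p⁻ x p y∈ with x∈p∪q⁻ ⁅ x ⁆ p y∈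
... | inj₁ y∈⁅x⁆ = inj₁ (x∈⁅y⁆⇒x≡y x y∈⁅x⁆)
... | inj₂ y∈p   = inj₂ y∈p

∪-swap : ∀ {n} (p q r : Subset n) → p ∪ (q ∪ r) ≡ q ∪ (p ∪ r)
∪-swap p q r = trans (sym (∪-assoc p q r)) (trans (cong (_∪ r) (∪-comm p q)) (∪-assoc q p r))

toggle-involutive : ∀ {n} (p : Subset n) v → (p [ v ]%= not) [ v ]%= not ≡ p
toggle-involutive p v = trans (updateAt-updateAt v p) (trans (updateAt-cong v not-involutive p) (updateAt-id v p))

∪-toggle : ∀ {n} (p q : Subset n) v → v ∉ q → (p ∪ q) [ v ]%= not ≡ (p [ v ]%= not) ∪ q
∪-toggle (x ∷ p) (true ∷ q) Fin.zero v∉q = ⊥-elim (v∉q here)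
∪-toggle (true ∷ p) (false ∷ q) Fin.zero _ = refl
∪-toggle (false ∷ p) (false ∷ q) Fin.zero _ = refl
∪-toggle (x ∷ p) (y ∷ q) (Fin.suc v) v∉q = cong ((x ∨ y) ∷_) (∪-toggle p q v (v∉q ∘ there))

⊥-toggle : ∀ {n} (v : Fin n) → ⊥ [ v ]%= not ≡ ⁅ v ⁆
⊥-toggle Fin.zero = refl
⊥-toggle (Fin.suc v) = cong (false ∷_) (⊥-toggle v)

toggle-∉ : ∀ {n} (p : Subset n) v → v ∉ p → p [ v ]%= not ≡ ⁅ v ⁆ ∪ p
toggle-∉ p v v∉p = begin
  p [ v ]%= not          ≡⟨ cong (_[ v ]%= not) (∪-identityˡ p) ⟨
  (⊥ ∪ p) [ v ]%= not    ≡⟨ ∪-toggle ⊥ p v v∉p ⟩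
  (⊥ [ v ]%= not) ∪ p    ≡⟨ cong (_∪ p) (⊥-toggle v) ⟩
  ⁅ v ⁆ ∪ p              ∎
  where open ≡-Reasoning

2+inner≡2^ : ∀ h → suc (suc (inner h)) ≡ 2 ^ suc h
2+inner≡2^ zero = refl
2+inner≡2^ (suc h) = trans (double (inner h)) (cong (2 *_) (2+inner≡2^ h))
  where
  double : ∀ x → suc (suc (suc (suc (x + x)))) ≡ 2 * suc (suc x)
  double = solve-∀

2*[1+x] : ∀ x → 2 * suc x ≡ suc (suc (2 * x))
2*[1+x] = solve-∀

module Tree (H : ℕ) where

  Vertex : Set
  Vertex = Fin (treeSize H)

  Config : Set
  Config = Subset (treeSize H)

  data PebblingIn (U : Vertex → Set) (s : ℕ) : Config → Config → Set where
    done : ∀ {P} → ∣ P ∣ ≤ s → PebblingIn U s P P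
    step : ∀ {P R} v → ∣ P ∣ ≤ s → U v → PredsIn H P v → PebblingIn U s (P [ v ]%= not) R → PebblingIn U s P R

  toPebbling : ∀ {U s P Q} → PebblingIn U s P Q → Pebbling H s P Q
  toPebbling (done |P|≤s) = done |P|≤s
  toPebbling (step v |P|≤s _ preds rest) = step |P|≤s (v , preds , refl) (toPebbling rest)

  start-≤ : ∀ {U s P Q} → PebblingIn U s P Q → ∣ P ∣ ≤ s
  start-≤ (done |P|≤s) = |P|≤s
  start-≤ (step _ |P|≤s _ _ _) = |P|≤s

  cast : ∀ {U s P P′ Q Q′} → P ≡ P′ → Q ≡ Q′ → PebblingIn U s P Q → PebblingIn U s P′ Q′
  cast refl refl π = π

  infixr 5 _⨾_

  _⨾_ : ∀ {U s P Q R} → PebblingIn U s P Q → PebblingIn U s Q R → PebblingIn U s P R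
  done _ ⨾ σ = σ
  step v |P|≤s v∈U preds π ⨾ σ = step v |P|≤s v∈U preds (π ⨾ σ)

  raise : ∀ {U s s′ P Q} → s ≤ s′ → PebblingIn U s P Q → PebblingIn U s′ P Q
  raise s≤s′ (done |P|≤s) = done (≤-trans |P|≤s s≤s′)
  raise s≤s′ (step v |P|≤s v∈U preds π) = step v (≤-trans |P|≤s s≤s′) v∈U preds (raise s≤s′ π)

  widen : ∀ {U V : Vertex → Set} {s P Q} → (∀ {v} → U v → V v) → PebblingIn U s P Q → PebblingIn V s P Q
  widen U⊆V (done |P|≤s) = done |P|≤s
  widen U⊆V (step v |P|≤s v∈U preds π) = step v |P|≤s (U⊆V v∈U) preds (widen U⊆V π)

  IsPred⇒≢ : ∀ {u v : Vertex} → IsPred u v → u ≢ v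
  IsPred⇒≢ {v = v} (inj₁ eq) refl = <⇒≢ (s≤s (m≤m+n (toℕ v) _)) eq
  IsPred⇒≢ {v = v} (inj₂ eq) refl = <⇒≢ (s≤s (m≤n⇒m≤1+n (m≤m+n (toℕ v) _))) eq

  -- A move is allowed both ways because toggling v leaves the pebbles on its predecessors in place.
  reverse : ∀ {U s P Q} → PebblingIn U s P Q → PebblingIn U s Q P
  reverse (done |P|≤s) = done |P|≤s
  reverse {U} {s} {P} (step v |P|≤s v∈U preds π) =
    reverse π ⨾ step v (start-≤ π) v∈U preds′ (cast (sym (toggle-involutive P v)) refl (done |P|≤s))
    where
    preds′ : PredsIn H (P [ v ]%= not) v
    preds′ u u→v = updateAt-minimal u v P (IsPred⇒≢ u→v) (preds u u→v)

  ∣P∪F∣≤s+∣F∣ : ∀ {s} (P F : Config) → ∣ P ∣ ≤ s → ∣ P ∪ F ∣ ≤ s + ∣ F ∣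
  ∣P∪F∣≤s+∣F∣ P F |P|≤s = ≤-trans (∣p∪q∣≤∣p∣+∣q∣ P F) (+-monoˡ-≤ ∣ F ∣ |P|≤s)

  frame : ∀ {U s P Q} F → (∀ {v} → U v → v ∉ F) → PebblingIn U s P Q → PebblingIn U (s + ∣ F ∣) (P ∪ F) (Q ∪ F)
  frame {P = P} F U∩F=∅ (done |P|≤s) = done (∣P∪F∣≤s+∣F∣ P F |P|≤s)
  frame {U} {s} {P} {Q} F U∩F=∅ (step v |P|≤s v∈U preds π) =
    step v (∣P∪F∣≤s+∣F∣ P F |P|≤s) v∈U (λ u u→v → p⊆p∪q F (preds u u→v))
      (cast (sym (∪-toggle P F v (U∩F=∅ v∈U))) refl (frame F U∩F=∅ π))

  frame⊥ : ∀ {U s Q} F → (∀ {v} → U v → v ∉ F) → PebblingIn U s ⊥ Q → PebblingIn U (s + ∣ F ∣) F (Q ∪ F)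
  frame⊥ F U∩F=∅ π = cast (∪-identityˡ F) refl (frame F U∩F=∅ π)

  Marked : (ℕ → Vertex) → ℕ → Config
  Marked y zero = ⊥
  Marked y (suc t) = ⁅ y (suc t) ⁆ ∪ Marked y t

  ∣Marked∣≤ : ∀ y t → ∣ Marked y t ∣ ≤ t
  ∣Marked∣≤ y zero = ≤-reflexive (∣⊥∣≡0 (treeSize H))
  ∣Marked∣≤ y (suc t) = ≤-trans (∣⁅x⁆∪p∣≤1+∣p∣ (y (suc t)) (Marked y t)) (s≤s (∣Marked∣≤ y t))

  ∈Marked⁻ : ∀ y {t u} → u ∈ Marked y t → ∃[ i ] 1 ≤ i × i ≤ t × u ≡ y i
  ∈Marked⁻ y {zero} u∈ = ⊥-elim (∉⊥ u∈)
  ∈Marked⁻ y {suc t} u∈ with ∈⁅x⁆∪p⁻ (y (suc t)) (Marked y t) u∈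
  ... | inj₁ u≡ = suc t , s≤s z≤n , ≤-refl , u≡
  ... | inj₂ u∈′ with ∈Marked⁻ y u∈′
  ...   | i , 1≤i , i≤t , u≡ = i , 1≤i , m≤n⇒m≤1+n i≤t , u≡

  ∈Marked⁺ : ∀ y {t i} → 1 ≤ i → i ≤ t → y i ∈ Marked y t
  ∈Marked⁺ y {zero} 1≤i i≤0 = ⊥-elim (<-irrefl refl (≤-trans 1≤i i≤0))
  ∈Marked⁺ y {suc t} {i} 1≤i i≤1+t with m≤n⇒m<n∨m≡n i≤1+t
  ... | inj₁ i≤t  = x∈p∪q⁺ (inj₂ (∈Marked⁺ y 1≤i (≤-pred i≤t)))
  ... | inj₂ refl = x∈p∪q⁺ (inj₁ (x∈⁅x⁆ _))

  Within : (ℕ → Vertex → Set) → ℕ → Vertex → Set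
  Within U n u = ∃[ j ] j < n × U (suc j) u

  pebble-each : ∀ (y : ℕ → Vertex) (U : ℕ → Vertex → Set) s n
    → (∀ {i j u} → 1 ≤ i → i < j → j ≤ n → U j u → u ≢ y i)
    → (∀ j → j < n → ∃[ s′ ] s′ + j ≤ s × PebblingIn (U (suc j)) s′ ⊥ ⁅ y (suc j) ⁆)
    → PebblingIn (Within U n) s ⊥ (Marked y n)
  pebble-each y U s zero _ _ = done (≤-trans (≤-reflexive (∣⊥∣≡0 (treeSize H))) z≤n)
  pebble-each y U s (suc n) disjoint pebble with pebble n ≤-refl
  ... | s′ , s′+n≤s , π =
        widen (λ (j , j<n , u∈) → j , m≤n⇒m≤1+n j<n , u∈)
          (pebble-each y U s n (λ 1≤i i<j j≤n → disjoint 1≤i i<j (m≤n⇒m≤1+n j≤n))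
                               (λ j j<n → pebble j (m≤n⇒m≤1+n j<n)))
      ⨾ widen (λ u∈ → n , ≤-refl , u∈)
          (raise (≤-trans (+-monoʳ-≤ s′ (∣Marked∣≤ y n)) s′+n≤s) (frame⊥ (Marked y n) fresh π))
    where
    fresh : ∀ {v} → U (suc n) v → v ∉ Marked y n
    fresh v∈U v∈M with ∈Marked⁻ y v∈M
    ... | i , 1≤i , i≤n , v≡yi = disjoint 1≤i (s≤s i≤n) ≤-refl v∈U v≡yi

  module Segments (x : ℕ → Vertex) (K : ℕ) (x-injective : ∀ {i j} → i < j → j ≤ K → x i ≢ x j) where

    OnSegment : ℕ → ℕ → Vertex → Set
    OnSegment t n u = ∃[ i ] t ≤ i × i < n + t × u ≡ x i

    record Segment (F : Config) (t n : ℕ) : Set where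
      field
        source≤K  : n + t ≤ K
        source∈F  : x (n + t) ∈ F
        fed    : ∀ {i u} → t ≤ i → i < n + t → IsPred u (x i) → u ≡ x (suc i) ⊎ u ∈ F
        avoids : ∀ {i} → t ≤ i → i < n + t → x i ∉ F
    open Segment

    upper-part : ∀ {F t} q p → Segment F t (q + p) → Segment F (p + t) q
    upper-part {F} {t} q p S = record
      { source≤K  = subst (_≤ K) assoc (source≤K S)
      ; source∈F  = subst (λ z → x z ∈ F) assoc (source∈F S)
      ; fed    = λ {i} p+t≤i i< → fed S (≤-trans (m≤n+m t p) p+t≤i) (subst (i <_) (sym assoc) i<)
      ; avoids = λ {i} p+t≤i i< → avoids S (≤-trans (m≤n+m t p) p+t≤i) (subst (i <_) (sym assoc) i<)
      }
      where
      assoc : q + p + t ≡ q + (p + t)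
      assoc = +-assoc q p t

    lower-part : ∀ {F t} q p → Segment F t (q + p) → Segment (⁅ x (p + t) ⁆ ∪ F) t p
    lower-part {F} {t} q p S = record
      { source≤K  = ≤-trans p+t≤ (source≤K S)
      ; source∈F  = x∈p∪q⁺ (inj₁ (x∈⁅x⁆ _))
      ; fed    = λ t≤i i< u→x-i → map₂ (x∈p∪q⁺ ∘ inj₂) (fed S t≤i (<-≤-trans i< p+t≤) u→x-i)
      ; avoids = λ t≤i i< x-i∈ →
          [ x-injective i< (≤-trans p+t≤ (source≤K S)) , avoids S t≤i (<-≤-trans i< p+t≤) ] (∈⁅x⁆∪p⁻ _ F x-i∈)
      }
      where
      p+t≤ : p + t ≤ q + p + t
      p+t≤ = +-monoˡ-≤ t (m≤n+m p q)

    add-pebble : ∀ {F t n} v → (∀ {i} → t ≤ i → i < n + t → x i ≢ v) → Segment F t n → Segment (⁅ v ⁆ ∪ F) t n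
    add-pebble {F} v off S = record
      { source≤K  = source≤K S
      ; source∈F  = x∈p∪q⁺ (inj₂ (source∈F S))
      ; fed    = λ t≤i i< u→x-i → map₂ (x∈p∪q⁺ ∘ inj₂) (fed S t≤i i< u→x-i)
      ; avoids = λ t≤i i< x-i∈ → [ off t≤i i< , avoids S t≤i i< ] (∈⁅x⁆∪p⁻ v F x-i∈)
      }

    SegmentPebbling : ℕ → ℕ → Set
    SegmentPebbling c n = ∀ {F t} → Segment F t n → PebblingIn (OnSegment t n) (suc c + ∣ F ∣) F (⁅ x t ⁆ ∪ F)

    segment-mono : ∀ {c c′ n} → c ≤ c′ → SegmentPebbling c n → SegmentPebbling c′ n
    segment-mono c≤c′ pebble S = raise (+-monoˡ-≤ _ (s≤s c≤c′)) (pebble S)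

    segment-one : SegmentPebbling 0 1
    segment-one {F} {t} S = step (x t) (n≤1+n _) (t , ≤-refl , ≤-refl , refl) preds
        (cast (sym (toggle-∉ F (x t) (avoids S ≤-refl ≤-refl))) refl (done (∣⁅x⁆∪p∣≤1+∣p∣ (x t) F)))
      where
      preds : PredsIn H F (x t)
      preds u u→xt with fed S ≤-refl ≤-refl u→xt
      ... | inj₁ refl = source∈F S
      ... | inj₂ u∈F  = u∈F

    -- Bennett: pebble x (p + t) from the top, then x t from x (p + t), then unpebble x (p + t) by running the
    -- first pebbling backwards; each stage holds at most one pebble more than a pebbling of a half.
    segment-join : ∀ {c} q p → 1 ≤ p → SegmentPebbling c q → SegmentPebbling c p → SegmentPebbling (suc c) (q + p)
    segment-join {c} q p 1≤p pebble-q pebble-p {F} {t} S =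
         widen from-upper (raise (one-more F (n≤1+n _)) (pebble-q Sᵘ))
      ⨾  widen from-lower (cast refl (∪-swap ⁅ x t ⁆ ⁅ x (p + t) ⁆ F)
           (raise (one-more (⁅ x (p + t) ⁆ ∪ F) (∣⁅x⁆∪p∣≤1+∣p∣ (x (p + t)) F)) (pebble-p (lower-part q p S))))
      ⨾  widen from-upper (reverse (raise (one-more (⁅ x t ⁆ ∪ F) (∣⁅x⁆∪p∣≤1+∣p∣ (x t) F)) (pebble-q (add-pebble (x t) off-t Sᵘ))))
      where
      Sᵘ : Segment F (p + t) q
      Sᵘ = upper-part q p S
      one-more : ∀ F′ → ∣ F′ ∣ ≤ suc ∣ F ∣ → suc c + ∣ F′ ∣ ≤ suc (suc c) + ∣ F ∣
      one-more _ le = ≤-trans (+-monoʳ-≤ (suc c) le) (≤-reflexive (+-suc (suc c) ∣ F ∣))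
      from-upper : ∀ {u} → OnSegment (p + t) q u → OnSegment t (q + p) u
      from-upper (i , p+t≤i , i< , eq) =
        i , ≤-trans (m≤n+m t p) p+t≤i , subst (i <_) (sym (+-assoc q p t)) i< , eq
      from-lower : ∀ {u} → OnSegment t p u → OnSegment t (q + p) u
      from-lower (i , t≤i , i< , eq) = i , t≤i , <-≤-trans i< (+-monoˡ-≤ t (m≤n+m p q)) , eq
      off-t : ∀ {i} → p + t ≤ i → i < q + (p + t) → x i ≢ x t
      off-t p+t≤i i< = ≢-sym (x-injective (<-≤-trans (m<n+m t 1≤p) p+t≤i) (<⇒≤ (<-≤-trans i< (source≤K Sᵘ))))

    segment-pebbling : ∀ c n → 1 ≤ n → n ≤ 2 ^ c → SegmentPebbling c n
    segment-pebbling c (suc zero) _ _ = segment-mono z≤n segment-one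
    segment-pebbling zero (suc (suc _)) _ (s≤s ())
    segment-pebbling (suc c) n@(suc (suc _)) 1≤n n≤2^[1+c] {F} {t} with n ≤? 2 ^ c
    ... | yes n≤2^c = segment-mono (n≤1+n c) (segment-pebbling c n 1≤n n≤2^c)
    ... | no n≰2^c  = subst (SegmentPebbling (suc c)) (m+[n∸m]≡n (<⇒≤ 2^c<n))
          (segment-join (2 ^ c) (n ∸ 2 ^ c) (m<n⇒0<n∸m 2^c<n)
             (segment-pebbling c (2 ^ c) (1≤2^ c) ≤-refl)
             (segment-pebbling c (n ∸ 2 ^ c) (m<n⇒0<n∸m 2^c<n) rest≤2^c)) {F} {t}
      where
      2^c<n : 2 ^ c < n
      2^c<n = ≰⇒> n≰2^c
      rest≤2^c : n ∸ 2 ^ c ≤ 2 ^ c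
      rest≤2^c = ≤-trans (∸-monoˡ-≤ (2 ^ c) n≤2^[1+c])
                         (≤-reflexive (trans (m+n∸m≡n (2 ^ c) (2 ^ c + 0)) (+-identityʳ _)))

  -- vertex y is the vertex with heap number y; for y = 0 or y beyond the tree it is a junk value.
  vertex : ℕ → Vertex
  vertex zero = Fin.zero
  vertex (suc y) with y <? treeSize H
  ... | yes y<N = fromℕ< y<N
  ... | no _    = Fin.zero

  vertex-toℕ : ∀ u → vertex (suc (toℕ u)) ≡ u
  vertex-toℕ u with toℕ u <? treeSize H
  ... | yes u<N = toℕ-injective (toℕ-fromℕ< u<N)
  ... | no u≮N  = ⊥-elim (u≮N (toℕ<n u))

  ≡vertex : ∀ {u y} → suc (toℕ u) ≡ y → u ≡ vertex y
  ≡vertex {u} refl = sym (vertex-toℕ u)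

  toℕ-vertex : ∀ {k y} → AtHeight H k y → suc (toℕ (vertex y)) ≡ y
  toℕ-vertex {y = zero} hy with AtHeight⇒1≤ hy
  ... | ()
  toℕ-vertex {y = suc y} hy with y <? treeSize H
  ... | yes y<N = cong suc (toℕ-fromℕ< y<N)
  ... | no y≮N  = ⊥-elim (y≮N (≤-pred (subst (suc (suc y) ≤_) (sym (2+inner≡2^ H)) (AtHeight⇒< hy))))

  suc-toℕ<2^ : ∀ (u : Vertex) → suc (toℕ u) < 2 ^ suc H
  suc-toℕ<2^ u = subst (suc (suc (toℕ u)) ≤_) (2+inner≡2^ H) (s≤s (toℕ<n u))

  IsPred-children : ∀ {u v : Vertex} {y} → suc (toℕ v) ≡ y → IsPred u v → suc (toℕ u) ≡ 2 * y ⊎ suc (toℕ u) ≡ suc (2 * y)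
  IsPred-children {v = v} refl (inj₁ eq) = inj₁ (trans (cong suc eq) (sym (2*[1+x] (toℕ v))))
  IsPred-children {v = v} refl (inj₂ eq) = inj₂ (trans (cong suc eq) (cong suc (sym (2*[1+x] (toℕ v)))))

  InSubtree : ℕ → Vertex → Set
  InSubtree m u = m ≼ suc (toℕ u)

  -- Remembering the region a pebbling moves in is what allows pebblings of disjoint subtrees to be framed.
  Pebblable : ℕ → ℕ → Set
  Pebblable Δ k = ∀ m → AtHeight H k m → PebblingIn (InSubtree m) (k + Δ) ⊥ ⁅ vertex m ⁆

  Pebblable-suc : ∀ {Δ k} → Pebblable Δ k → Pebblable (suc Δ) k
  Pebblable-suc {Δ} {k} pebble m hm = raise (+-monoʳ-≤ k (n≤1+n Δ)) (pebble m hm)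

  pebblable-leaf : ∀ {Δ} → 1 ≤ Δ → Pebblable Δ 0
  pebblable-leaf 1≤Δ m hm =
    step v (≤-trans (≤-reflexive (∣⊥∣≡0 (treeSize H))) z≤n) (subst (m ≼_) (sym v≡m) (≼-refl m)) no-preds
      (cast (sym (⊥-toggle v)) refl (done (subst (_≤ _) (sym (∣⁅x⁆∣≡1 v)) 1≤Δ)))
    where
    v : Vertex
    v = vertex m
    v≡m : suc (toℕ v) ≡ m
    v≡m = toℕ-vertex hm
    no-preds : PredsIn H ⊥ v
    no-preds u u→v = ⊥-elim (<-irrefl refl (<-≤-trans (suc-toℕ<2^ u) (≤-trans (AtHeight-0 hm) 2m≤u)))
      where
      2m≤u : 2 * m ≤ suc (toℕ u)
      2m≤u = [ ≤-reflexive ∘ sym , (λ eq → ≤-trans (n≤1+n _) (≤-reflexive (sym eq))) ] (IsPred-children v≡m u→v)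

  module SpineSplit {d a b m} (1≤b : 1 ≤ b) (b≤2^ : b ≤ 2 ^ (a + d)) (hm : AtHeight H (a + b) m)
                    (bottom : Pebblable (suc d) a) (siblings : ∀ {j} → j < a + b → Pebblable (suc (suc d)) j) where

    1≤m : 1 ≤ m
    1≤m = AtHeight⇒1≤ hm

    spine : ℕ → Vertex
    spine i = vertex (m * 2 ^ i)

    sibling : ℕ → Vertex
    sibling i = vertex (suc (m * 2 ^ i))

    toℕ-spine : ∀ {i} → i ≤ b → suc (toℕ (spine i)) ≡ m * 2 ^ i
    toℕ-spine i≤b = toℕ-vertex (AtHeight-spine (≤-trans i≤b (m≤n+m b a)) hm)

    toℕ-sibling : ∀ {i} → 1 ≤ i → i ≤ b → suc (toℕ (sibling i)) ≡ suc (m * 2 ^ i)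
    toℕ-sibling 1≤i i≤b = toℕ-vertex (AtHeight-sibling 1≤i (≤-trans i≤b (m≤n+m b a)) hm)

    spine-injective : ∀ {i j} → i < j → j ≤ b → spine i ≢ spine j
    spine-injective i<j j≤b eq = <-irrefl
      (trans (sym (toℕ-spine (≤-trans (n≤1+n _) (≤-trans i<j j≤b)))) (trans (cong (suc ∘ toℕ) eq) (toℕ-spine j≤b)))
      (*2^-monoʳ-< 1≤m i<j)

    spine-∉-siblings : ∀ {i} → i ≤ b → spine i ∉ Marked sibling b
    spine-∉-siblings {i} i≤b spine-i∈ with ∈Marked⁻ sibling spine-i∈
    ... | k , 1≤k , k≤b , eq = sibling-⋠-spine i 1≤m 1≤k (subst (suc (m * 2 ^ k) ≼_) same-node (≼-refl _))
      where
      same-node : suc (m * 2 ^ k) ≡ m * 2 ^ i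
      same-node = trans (sym (toℕ-sibling 1≤k k≤b)) (trans (cong (suc ∘ toℕ) (sym eq)) (toℕ-spine i≤b))

    SiblingRegion : Vertex → Set
    SiblingRegion = Within (λ i → InSubtree (suc (m * 2 ^ i))) b

    siblings-pebbled : PebblingIn SiblingRegion (a + b + suc d) ⊥ (Marked sibling b)
    siblings-pebbled = pebble-each sibling (λ i → InSubtree (suc (m * 2 ^ i))) (a + b + suc d) b disjoint pebble
      where
      disjoint : ∀ {i j u} → 1 ≤ i → i < j → j ≤ b → InSubtree (suc (m * 2 ^ j)) u → u ≢ sibling i
      disjoint {i} {j} 1≤i i<j j≤b u∈ refl = sibling-⋠-sibling {i = j} 1≤m (≤-trans 1≤i (<⇒≤ i<j)) (≢-sym (<⇒≢ i<j))
        (subst (suc (m * 2 ^ j) ≼_) (toℕ-sibling 1≤i (≤-trans (<⇒≤ i<j) j≤b)) u∈)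
      pebble : ∀ j → j < b → ∃[ s′ ] s′ + j ≤ a + b + suc d × PebblingIn (InSubtree (suc (m * 2 ^ suc j))) s′ ⊥ ⁅ sibling (suc j) ⁆
      pebble j j<b = a + b ∸ suc j + suc (suc d) , ≤-reflexive cost
                   , siblings (∸-monoʳ-< (s≤s z≤n) 1+j≤a+b) _ (AtHeight-sibling (s≤s z≤n) 1+j≤a+b hm)
        where
        1+j≤a+b : suc j ≤ a + b
        1+j≤a+b = ≤-trans j<b (m≤n+m b a)
        shuffle : ∀ r d j → r + suc (suc d) + j ≡ r + suc j + suc d
        shuffle = solve-∀
        cost : a + b ∸ suc j + suc (suc d) + j ≡ a + b + suc d
        cost = trans (shuffle (a + b ∸ suc j) d j) (cong (_+ suc d) (m∸n+n≡m 1+j≤a+b))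

    bottom-pebbled : PebblingIn (InSubtree (m * 2 ^ b)) (a + suc d) ⊥ ⁅ spine b ⁆
    bottom-pebbled = bottom (m * 2 ^ b) (AtHeight-≼ hm (≼[]-spine m b))

    bottom-avoids-siblings : ∀ {u} → InSubtree (m * 2 ^ b) u → u ∉ Marked sibling b
    bottom-avoids-siblings u∈ u∈M with ∈Marked⁻ sibling u∈M
    ... | i , 1≤i , i≤b , refl = spine-⋠-sibling 1≤m 1≤i i≤b (subst (m * 2 ^ b ≼_) (toℕ-sibling 1≤i i≤b) u∈)

    bottom-avoids-top : ∀ {u} → InSubtree (m * 2 ^ b) u → u ≢ spine 0
    bottom-avoids-top u∈ refl =
      <⇒≱ (*2^-monoʳ-< 1≤m 1≤b) (≼⇒≤ (subst (m * 2 ^ b ≼_) (toℕ-spine z≤n) u∈))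

    siblings-avoid-top : ∀ {u} → SiblingRegion u → u ≢ spine 0
    siblings-avoid-top (j , _ , u∈) refl =
      <⇒≱ (s≤s (*2^-monoʳ-≤ m {0} {suc j} z≤n)) (≼⇒≤ (subst (suc (m * 2 ^ suc j) ≼_) (toℕ-spine z≤n) u∈))

    open Segments spine b spine-injective

    held : Config
    held = ⁅ spine b ⁆ ∪ Marked sibling b

    spine-fed : ∀ {i u} → i < b → IsPred u (spine i) → u ≡ spine (suc i) ⊎ u ∈ held
    spine-fed {i} i<b u→ with IsPred-children (toℕ-spine (<⇒≤ i<b)) u→
    ... | inj₁ eq = inj₁ (trans (≡vertex eq) (cong vertex (sym (*2^-suc m i))))
    ... | inj₂ eq = inj₂ (x∈p∪q⁺ (inj₂ (subst (_∈ Marked sibling b) (sym (trans (≡vertex eq) (cong (vertex ∘ suc) (sym (*2^-suc m i)))))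
                                          (∈Marked⁺ sibling (s≤s z≤n) i<b))))

    spine-segment : Segment held 0 b
    spine-segment = record
      { source≤K  = ≤-reflexive b+0≡b
      ; source∈F  = subst (λ z → spine z ∈ held) (sym b+0≡b) (x∈p∪q⁺ (inj₁ (x∈⁅x⁆ _)))
      ; fed    = λ _ i< → spine-fed (<-≤-trans i< (≤-reflexive b+0≡b))
      ; avoids = λ _ i< spine-i∈ → [ spine-injective (<-≤-trans i< (≤-reflexive b+0≡b)) ≤-refl
                                    , spine-∉-siblings (<⇒≤ (<-≤-trans i< (≤-reflexive b+0≡b))) ]
                                    (∈⁅x⁆∪p⁻ _ _ spine-i∈)
      }
      where
      b+0≡b : b + 0 ≡ b
      b+0≡b = +-identityʳ b

    spine-pebbled : PebblingIn (OnSegment 0 b) (suc (a + d) + ∣ held ∣) held (⁅ spine 0 ⁆ ∪ held)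
    spine-pebbled = segment-pebbling (a + d) b 1≤b b≤2^ spine-segment

    sibling⊆ : ∀ {u} → SiblingRegion u → InSubtree m u
    sibling⊆ (j , _ , u∈) = ≼-trans (suc j , ≼[]-sibling m (s≤s z≤n)) u∈

    bottom⊆ : ∀ {u} → InSubtree (m * 2 ^ b) u → InSubtree m u
    bottom⊆ u∈ = ≼-trans (b , ≼[]-spine m b) u∈

    spine⊆ : ∀ {u} → OnSegment 0 b u → InSubtree m u
    spine⊆ (i , _ , i< , refl) = subst (m ≼_) (sym (toℕ-spine (<⇒≤ (<-≤-trans i< (≤-reflexive (+-identityʳ b))))))
                                       (i , ≼[]-spine m i)

    budget : ∀ {f} → f ≤ suc b → a + suc d + f ≤ a + b + suc (suc d)
    budget f≤ = ≤-trans (+-monoʳ-≤ (a + suc d) f≤) (≤-reflexive (regroup a b d))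
      where
      regroup : ∀ a b d → a + suc d + suc b ≡ a + b + suc (suc d)
      regroup = solve-∀

    pebbling : PebblingIn (InSubtree m) (a + b + suc (suc d)) ⊥ ⁅ spine 0 ⁆
    pebbling =
         widen sibling⊆ (raise (+-monoʳ-≤ (a + b) (n≤1+n _)) siblings-pebbled)
      ⨾  widen bottom⊆ (raise (budget (m≤n⇒m≤1+n (∣Marked∣≤ sibling b)))
           (frame⊥ (Marked sibling b) bottom-avoids-siblings bottom-pebbled))
      ⨾  widen spine⊆ (raise (subst (_≤ a + b + suc (suc d)) (cong (_+ ∣ held ∣) (+-suc a d)) (budget (held≤ (spine b)))) spine-pebbled)
      ⨾  widen bottom⊆ (cast (∪-swap _ _ _) refl (reverse (raise (budget (held≤ (spine 0)))
           (frame⊥ (⁅ spine 0 ⁆ ∪ Marked sibling b) bottom-avoids-top+siblings bottom-pebbled))))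
      ⨾  widen sibling⊆ (cast (∪-comm _ _) refl (reverse (raise last-cost
           (frame⊥ ⁅ spine 0 ⁆ (λ u∈ → siblings-avoid-top u∈ ∘ x∈⁅y⁆⇒x≡y _) siblings-pebbled))))
      where
      held≤ : ∀ v → ∣ ⁅ v ⁆ ∪ Marked sibling b ∣ ≤ suc b
      held≤ v = ≤-trans (∣⁅x⁆∪p∣≤1+∣p∣ v _) (s≤s (∣Marked∣≤ sibling b))
      bottom-avoids-top+siblings : ∀ {u} → InSubtree (m * 2 ^ b) u → u ∉ ⁅ spine 0 ⁆ ∪ Marked sibling b
      bottom-avoids-top+siblings u∈ u∈′ =
        [ bottom-avoids-top u∈ , bottom-avoids-siblings u∈ ] (∈⁅x⁆∪p⁻ _ _ u∈′)
      last-cost : a + b + suc d + ∣ ⁅ spine 0 ⁆ ∣ ≤ a + b + suc (suc d)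
      last-cost = ≤-reflexive (trans (cong (a + b + suc d +_) (∣⁅x⁆∣≡1 (spine 0))) (trans (+-assoc (a + b) (suc d) 1) (cong (a + b +_) (+-comm (suc d) 1))))

  pebblable-split : ∀ {d a b} → 1 ≤ b → b ≤ 2 ^ (a + d) → Pebblable (suc d) a
                  → (∀ {j} → j < a + b → Pebblable (suc (suc d)) j) → Pebblable (suc (suc d)) (a + b)
  pebblable-split 1≤b b≤2^ bottom siblings m hm =
    cast refl (cong (⁅_⁆ ∘ vertex) (*-identityʳ m)) (SpineSplit.pebbling 1≤b b≤2^ hm bottom siblings)

  pebblable : ∀ d k → k ≤ g (suc d) → Pebblable (suc d) k
  pebblable zero k k≤0 = subst (Pebblable 1) (sym (n≤0⇒n≡0 k≤0)) (pebblable-leaf ≤-refl)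
  pebblable (suc d) = <-rec (λ k → k ≤ g (suc (suc d)) → Pebblable (suc (suc d)) k) pebblable-below
    where
    pebblable-below : ∀ k → (∀ {j} → j < k → j ≤ g (suc (suc d)) → Pebblable (suc (suc d)) j)
                    → k ≤ g (suc (suc d)) → Pebblable (suc (suc d)) k
    pebblable-below k smaller k≤g with k ≤? g (suc d)
    ... | yes k≤a = Pebblable-suc (pebblable d k k≤a)
    ... | no k≰a  = subst (Pebblable (suc (suc d))) a+b≡k
          (pebblable-split 1≤b b≤2^ (pebblable d a ≤-refl)
             (λ j<a+b → smaller (subst (_ <_) a+b≡k j<a+b) (<⇒≤ (<-≤-trans (subst (_ <_) a+b≡k j<a+b) k≤g))))
      where
      a = g (suc d)
      a<k : a < k
      a<k = ≰⇒> k≰a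
      a+b≡k : a + (k ∸ a) ≡ k
      a+b≡k = m+[n∸m]≡n (<⇒≤ a<k)
      1≤b : 1 ≤ k ∸ a
      1≤b = m<n⇒0<n∸m a<k
      b≤2^ : k ∸ a ≤ 2 ^ (a + d)
      b≤2^ = ≤-trans (∸-monoˡ-≤ a k≤g) (≤-reflexive (m+n∸n≡m (2 ^ (a + d)) a))

lemma5p5 : (Δ h : ℕ) → 1 ≤ Δ → h ≤ g Δ → PersistentPriceAtMost h (h + Δ)
lemma5p5 (suc d) h _ h≤g = toPebbling (cast refl (cong ⁅_⁆ (vertex-toℕ (root h))) (pebblable d h h≤g 1 (AtHeight-root h)))
  where open Tree h
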